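{- Let $b\ge 2$ be an integer, let $f,g:\mathbb{N}\to\mathbb{N}$, and let $\alpha\in[0,1)$ be such that its base $b$ digit sequence is the concatenation $w_1w_2w_3\cdots$, where for each $j\ge1$ the word $w_j$ has length $g(j)b^{f(j)}$ and is a $b$-ary $(f(j),g(j))$-nested semi-perfect necklace. For $m\ge 2$ set $n_m:=\sum_{j=1}^{m-1} g(j)b^{f(j)}$. Then the star discrepancy $D^*_{n_m}$ of the finite sequence $(\{b^n\alpha\})_{n=0,1,\ldots,n_m-1}$ satisfies $$n_m D^*_{n_m}\le \sum_{j=1}^{m-1} f(j)+\sum_{j=1}^{m-1} g(j).$$
   Context: $\{x\}$ denotes the fractional part of $x$. For points $x_0,\ldots,x_{N-1}$ in $[0,1)$, the star discrepancy is $D_N^*=\sup_{0<c\le 1}\left|\frac1N\#\{0\le n<N: x_n\in[0,c)\}-c\right|$. A necklace is a word considered up to rotation, so occurrences of subwords are counted circularly. A $b$-ary necklace is $(k,l)$-semi perfect if its length is $lb^k$ and each word of length $k$ over $\{0,\ldots,b-1\}$ occurs in it (circularly) exactly $l$ times. A $b$-ary word $w$ is a $(k,l)$-nested semi-perfect necklace if for each $j\in\{1,\ldots,k\}$, each block of $w$ of length $lb^j$ starting at a position congruent to $1$ modulo $lb^j$ is a $(j,l)$-semi perfect necklace. -}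

module Defs where

open import Data.Nat using (ℕ; zero; suc; _+_; _*_; _∸_; _^_; _≤_; _<_)
open import Data.Nat.DivMod using (_%_)
open import Data.Fin using (Fin; toℕ)
open import Data.Fin.Properties using (all?; _≟_)
open import Data.Fin.Subset using (Subset; _∈_; ∣_∣)
open import Data.Vec using (Vec; lookup)
open import Data.List using (List; length; filter; upTo)
open import Data.Product using (_×_; ∃)
open import Relation.Binary.PropositionalEquality using (_≡_; _≢_)
open import Function.Bundles using (_⇔_)

-- A b-ary word of length L is represented by a function ℕ → Fin b;
-- only the values at positions 0,…,L-1 matter (0-indexed positions).

-- circular index: i mod L (the L = 0 case is never used)
circ : ℕ → ℕ → ℕ
circ zero    i = 0
circ (suc m) i = i % suc m

OccursAt : {b k : ℕ} → (L : ℕ) → (w : ℕ → Fin b) → Vec (Fin b) k → ℕ → Set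
OccursAt {k = k} L w u i = (t : Fin k) → w (circ L (i + toℕ t)) ≡ lookup u t

occ : {b k : ℕ} → (L : ℕ) → (w : ℕ → Fin b) → Vec (Fin b) k → ℕ
occ {k = k} L w u = length (filter (λ i → all? {P = λ t → w (circ L (i + toℕ t)) ≡ lookup u t}
                                               (λ t → w (circ L (i + toℕ t)) ≟ lookup u t)) (upTo L))

SemiPerfect : (b k l L : ℕ) → (ℕ → Fin b) → Set
SemiPerfect b k l L w = (L ≡ l * b ^ k) × ((u : Vec (Fin b) k) → occ L w u ≡ l)

-- (k,l)-nested semi-perfect necklace (w has length l*b^k): for each j ∈ {1..k},
-- each block of length l*b^j starting at (1-indexed) position ≡ 1 mod l*b^j,
-- i.e. 0-indexed start r*(l*b^j) with r < b^(k-j), is (j,l)-semi perfect.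
NestedSemiPerfect : (b k l : ℕ) → (ℕ → Fin b) → Set
NestedSemiPerfect b k l w =
  (j : ℕ) → 1 ≤ j → j ≤ k → (r : ℕ) → r < b ^ (k ∸ j) →
  SemiPerfect b j l (l * b ^ j) (λ i → w (r * (l * b ^ j) + i))

sum1 : (ℕ → ℕ) → ℕ → ℕ
sum1 h zero    = 0
sum1 h (suc n) = sum1 h n + h (suc n)

-- b^K times the truncation to K digits of the real Σ_{k≥0} d k b^{-(k+1)}
trunc : (b : ℕ) → ℕ → (ℕ → Fin b) → ℕ
trunc b zero    d = 0
trunc b (suc K) d = trunc b K d * b + toℕ (d K)

-- real value of digit stream x  <  real value of digit stream c
-- (x < c  iff  for some K, trunc_K(x) + b^{-K} < trunc_K(c))
DigLt : (b : ℕ) → (ℕ → Fin b) → (ℕ → Fin b) → Set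
DigLt b x c = ∃ λ K → suc (trunc b K x) < trunc b K c

-- c (given by digit stream) lies in (0,1]
Positive : (b : ℕ) → (ℕ → Fin b) → Set
Positive b c = ∃ λ k → toℕ (c k) ≢ 0

-- real value of c times N lies in [A - S, A + S]  (i.e. |A - N c| ≤ S)
NearCount : (b : ℕ) → (N A S : ℕ) → (ℕ → Fin b) → Set
NearCount b N A S c =
  ((K : ℕ) → N * trunc b K c ≤ (A + S) * b ^ K) ×
  ((K : ℕ) → (A ∸ S) * b ^ K ≤ N * (trunc b K c + 1))

-- N · D*_N ≤ S for the points x_n = {b^n α}, n < N, where α has digit stream a:
-- for every c ∈ (0,1] and A = #{n < N : x_n < c}, we have |A - N c| ≤ S.
-- x_n has digit stream i ↦ a (n + i). c ranges over all reals in (0,1] via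
-- base-b digit streams; the count A is given as a subset of Fin N.
StarDiscBound : (b : ℕ) → (ℕ → Fin b) → (N S : ℕ) → Set
StarDiscBound b a N S =
  (c : ℕ → Fin b) → Positive b c →
  (s : Subset N) → ((n : Fin N) → (n ∈ s) ⇔ DigLt b (λ i → a (toℕ n + i)) c) →
  NearCount b N ∣ s ∣ S c

-- a is a genuine base-b expansion: not eventually equal to b-1
NotEventuallyMax : (b : ℕ) → (ℕ → Fin b) → Set
NotEventuallyMax b a = (M : ℕ) → ∃ λ k → (M ≤ k) × (suc (toℕ (a k)) ≢ b)

{-# OPTIONS --safe #-}
module Submission where

-- Cut the first n_m digits of α into the blocks w_j. For a block of length L = l b^k starting at
-- s, compare each point {b^(s+i) α} with c through the integer formed by its first k digits and
-- T = ⌊b^k c⌋: a value below T puts the point below c (α is not eventually b - 1), and a point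
-- below c has value at most T. The top level of the nesting makes w_j a (k,l)-semi-perfect
-- necklace, so every value below b^k is taken by exactly l circular windows of length k, and the
-- actual windows differ from the circular ones only at the last k positions. Hence the number of
-- points of the block below c is within k of l T, so within k + l of L c, and these errors add
-- up over the blocks.

open import Data.Bool using (Bool; true; false)
import Data.Fin as Fin
open Fin using (Fin; toℕ; fromℕ<)
open import Data.Fin.Properties using (toℕ<n; toℕ-fromℕ<; toℕ-injective; all?) renaming (_≟_ to _≟ᶠ_)
open import Data.Fin.Subset using (Subset; _∈_; ∣_∣)
open import Data.List using (length; filter; applyUpTo; upTo)
open import Data.List.Properties using (filter-all; length-upTo)
open import Data.List.Relation.Unary.All using (universal)
open import Data.Nat
open import Data.Nat.DivMod using (m≡m%n+[m/n]*n; [m+kn]%n≡m%n; m<n⇒m%n≡m; m%n<n; m<n*o⇒m/o<n)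
open import Data.Nat.Properties
open import Algebra.Properties.CommutativeSemigroup +-commutativeSemigroup using (interchange)
open import Data.Nat.Tactic.RingSolver using (solve-∀)
open import Data.Product using (_×_; _,_; proj₁; proj₂; ∃)
open import Data.Sum using (inj₁; inj₂)
open import Data.Vec using ([]; _∷_; lookup; tabulate)
open import Data.Vec.Properties using (lookup∘tabulate; []=⇒lookup; lookup⇒[]=)
open import Function using (_∘_; id)
open import Function.Bundles using (_⇔_; mk⇔; Equivalence)
open import Level using (0ℓ)
open import Relation.Binary using (tri<; tri≈; tri>)
open import Relation.Binary.PropositionalEquality
open import Relation.Nullary using (Dec; yes; no; does)
open import Relation.Nullary.Decidable using (dec-true; dec-false; does-⇔)
open import Relation.Unary using (Pred; Decidable)

open import Defs

ind : Bool → ℕ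
ind true  = 1
ind false = 0

∑< : ℕ → (ℕ → ℕ) → ℕ
∑< zero    h = 0
∑< (suc n) h = h 0 + ∑< n (h ∘ suc)

syntax ∑< n (λ i → e) = ∑[ i < n ] e

∑-cong : ∀ n {h h′ : ℕ → ℕ} → (∀ i → i < n → h i ≡ h′ i) → ∑< n h ≡ ∑< n h′
∑-cong zero    _  = refl
∑-cong (suc n) eq = cong₂ _+_ (eq 0 z<s) (∑-cong n (λ i i<n → eq (suc i) (s<s i<n)))

∑-mono-≤ : ∀ n {h h′ : ℕ → ℕ} → (∀ i → i < n → h i ≤ h′ i) → ∑< n h ≤ ∑< n h′
∑-mono-≤ zero    _  = z≤n
∑-mono-≤ (suc n) le = +-mono-≤ (le 0 z<s) (∑-mono-≤ n (λ i i<n → le (suc i) (s<s i<n)))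

∑-distrib-+ : ∀ n (h h′ : ℕ → ℕ) → ∑[ i < n ] (h i + h′ i) ≡ ∑< n h + ∑< n h′
∑-distrib-+ zero    h h′ = refl
∑-distrib-+ (suc n) h h′ = trans (cong (h 0 + h′ 0 +_) (∑-distrib-+ n (h ∘ suc) (h′ ∘ suc)))
                                 (interchange (h 0) (h′ 0) (∑< n (h ∘ suc)) (∑< n (h′ ∘ suc)))

∑-split : ∀ m n (h : ℕ → ℕ) → ∑< (m + n) h ≡ ∑< m h + ∑[ i < n ] h (m + i)
∑-split zero    n h = refl
∑-split (suc m) n h = trans (cong (h 0 +_) (∑-split m n (h ∘ suc))) (sym (+-assoc (h 0) _ _))

∑-zero : ∀ n → ∑[ i < n ] 0 ≡ 0
∑-zero zero    = refl
∑-zero (suc n) = ∑-zero n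

∑-≤-length : ∀ n (h : ℕ → ℕ) → (∀ i → h i ≤ 1) → ∑< n h ≤ n
∑-≤-length zero    h h≤1 = z≤n
∑-≤-length (suc n) h h≤1 = +-mono-≤ (h≤1 0) (∑-≤-length n (h ∘ suc) (h≤1 ∘ suc))

∑-≤-∑-+-tail : ∀ n k (h h′ : ℕ → ℕ) → (∀ i → h i ≤ 1) → (∀ i → i + k ≤ n → h i ≡ h′ i) →
               ∑< n h ≤ ∑< n h′ + k
∑-≤-∑-+-tail n k h h′ h≤1 agree with k ≤? n
... | no  k≰n = ≤-trans (∑-≤-length n h h≤1) (≤-trans (<⇒≤ (≰⇒> k≰n)) (m≤n+m k _))
... | yes k≤n with m≤n⇒∃[o]m+o≡n k≤n
...   | m , refl = begin
  ∑< (k + m) h                               ≡⟨ cong (λ n → ∑< n h) (+-comm k m) ⟩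
  ∑< (m + k) h                               ≡⟨ ∑-split m k h ⟩
  ∑< m h + ∑[ i < k ] h (m + i)              ≤⟨ +-mono-≤ (≤-reflexive head) (∑-≤-length k _ (h≤1 ∘ (m +_))) ⟩
  ∑< m h′ + k                                ≤⟨ +-monoˡ-≤ k (m≤m+n _ _) ⟩
  ∑< m h′ + ∑[ i < k ] h′ (m + i) + k        ≡⟨ cong (_+ k) (sym (∑-split m k h′)) ⟩
  ∑< (m + k) h′ + k                          ≡⟨ cong (λ n → ∑< n h′ + k) (+-comm m k) ⟩
  ∑< (k + m) h′ + k                          ∎
  where
  open ≤-Reasoning
  head : ∑< m h ≡ ∑< m h′
  head = ∑-cong m (λ i i<m → agree i (≤-trans (<⇒≤ (+-monoˡ-< k i<m)) (≤-reflexive (+-comm m k))))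

length-filter-applyUpTo : ∀ {P : Pred ℕ 0ℓ} (P? : Decidable P) (f : ℕ → ℕ) n →
                          length (filter P? (applyUpTo f n)) ≡ ∑[ i < n ] ind (does (P? (f i)))
length-filter-applyUpTo P? f zero = refl
length-filter-applyUpTo P? f (suc n) with does (P? (f 0))
... | true  = cong suc (length-filter-applyUpTo P? (f ∘ suc) n)
... | false = length-filter-applyUpTo P? (f ∘ suc) n

ind≤1 : ∀ x → ind x ≤ 1
ind≤1 true  = ≤-refl
ind≤1 false = z≤n

ind-does-≤ : ∀ {P : Set} (P? : Dec P) {y} → (P → y ≡ true) → ind (does P?) ≤ ind y
ind-does-≤ (yes p) P⇒y rewrite P⇒y p = ≤-refl
ind-does-≤ (no  _) _ = z≤n

ind-≤-does : ∀ {P : Set} {x} (P? : Dec P) → (x ≡ true → P) → ind x ≤ ind (does P?)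
ind-≤-does {x = false} _  _ = z≤n
ind-≤-does {x = true}  P? x⇒P rewrite dec-true P? (x⇒P refl) = ≤-refl

ind-<-suc : ∀ x U → ind (does (x <? suc U)) ≡ ind (does (x <? U)) + ind (does (x ≟ U))
ind-<-suc x U with <-cmp x U
... | tri< x<U x≢U _
  rewrite dec-true (x <? suc U) (m<n⇒m<1+n x<U) | dec-true (x <? U) x<U | dec-false (x ≟ U) x≢U = refl
... | tri≈ _ refl _
  rewrite dec-true (x <? suc x) ≤-refl | dec-false (x <? x) (<-irrefl refl) | dec-true (x ≟ x) refl = refl
... | tri> x≮U x≢U U<x
  rewrite dec-false (x <? suc U) (λ x<1+U → ≤⇒≯ (s≤s⁻¹ x<1+U) U<x) | dec-false (x <? U) x≮U
        | dec-false (x ≟ U) x≢U = refl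

q*n+r<[1+q]*n : ∀ q {n r} → r < n → q * n + r < suc q * n
q*n+r<[1+q]*n q {n} {r} r<n = begin-strict
  q * n + r  <⟨ +-monoʳ-< (q * n) r<n ⟩
  q * n + n  ≡⟨ +-comm (q * n) n ⟩
  suc q * n  ∎
  where open ≤-Reasoning

*+-injective : ∀ {n q q′ r r′} .{{_ : NonZero n}} → r < n → r′ < n →
               q * n + r ≡ q′ * n + r′ → q ≡ q′ × r ≡ r′
*+-injective {n} {q} {q′} {r} {r′} r<n r′<n eq = q≡q′ , r≡r′
  where
  [q*n+r]%n≡r : ∀ q {r} → r < n → (q * n + r) % n ≡ r
  [q*n+r]%n≡r q {r} r<n =
    trans (cong (_% n) (+-comm (q * n) r)) (trans ([m+kn]%n≡m%n r q n) (m<n⇒m%n≡m r<n))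
  r≡r′ : r ≡ r′
  r≡r′ = trans (sym ([q*n+r]%n≡r q r<n)) (trans (cong (_% n) eq) ([q*n+r]%n≡r q′ r′<n))
  q≡q′ : q ≡ q′
  q≡q′ = *-cancelʳ-≡ q q′ n (+-cancelʳ-≡ r (q * n) (q′ * n) (trans eq (cong (q′ * n +_) (sym r≡r′))))

quot-rem : ∀ {m} U n .{{_ : NonZero n}} → U < m * n → ∃ λ q → ∃ λ r → q < m × r < n × q * n + r ≡ U
quot-rem U n U<m*n =
  U / n , U % n , m<n*o⇒m/o<n U<m*n , m%n<n U n ,
  trans (+-comm (U / n * n) (U % n)) (sym (m≡m%n+[m/n]*n U n))

shift : {A : Set} → (ℕ → A) → ℕ → ℕ → A
shift x n t = x (n + t)

circWindow : {A : Set} → ℕ → (ℕ → A) → ℕ → ℕ → A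
circWindow L w i t = w (circ L (i + t))

circ-< : ∀ {L n} → n < L → circ L n ≡ n
circ-< {suc L} n<L = m<n⇒m%n≡m n<L

χ : ∀ {n} → Subset n → ℕ → Bool
χ []      _       = false
χ (x ∷ _) zero    = x
χ (_ ∷ s) (suc i) = χ s i

χ-toℕ : ∀ {n} (s : Subset n) i → χ s (toℕ i) ≡ lookup s i
χ-toℕ (_ ∷ _) Fin.zero    = refl
χ-toℕ (_ ∷ s) (Fin.suc i) = χ-toℕ s i

∣∣≡∑χ : ∀ {n} (s : Subset n) → ∣ s ∣ ≡ ∑[ i < n ] ind (χ s i)
∣∣≡∑χ []          = refl
∣∣≡∑χ (true  ∷ s) = cong suc (∣∣≡∑χ s)
∣∣≡∑χ (false ∷ s) = ∣∣≡∑χ s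

χ⇔ : ∀ {n} (s : Subset n) {P : ℕ → Set} → (∀ i → i ∈ s ⇔ P (toℕ i)) → ∀ m → m < n → χ s m ≡ true ⇔ P m
χ⇔ s {P} ∈⇔P m m<n = subst (λ m → χ s m ≡ true ⇔ P m) (toℕ-fromℕ< m<n) (mk⇔
  (λ χ≡true → Equivalence.to (∈⇔P i) (lookup⇒[]= i s (trans (sym (χ-toℕ s i)) χ≡true)))
  (λ Pi → trans (χ-toℕ s i) ([]=⇒lookup (Equivalence.from (∈⇔P i) Pi))))
  where i = fromℕ< m<n

module _ (b : ℕ) .{{_ : NonZero b}} where

  trunc-cong : ∀ K {x y : ℕ → Fin b} → (∀ t → t < K → x t ≡ y t) → trunc b K x ≡ trunc b K y
  trunc-cong zero    _   = refl
  trunc-cong (suc K) x≗y =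
    cong₂ (λ q r → q * b + toℕ r) (trunc-cong K (λ t t<K → x≗y t (m<n⇒m<1+n t<K))) (x≗y K ≤-refl)

  trunc-injective : ∀ K {x y : ℕ → Fin b} → trunc b K x ≡ trunc b K y → ∀ t → t < K → x t ≡ y t
  trunc-injective (suc K) {x} {y} eq t t<1+K
    with *+-injective (toℕ<n (x K)) (toℕ<n (y K)) eq | m<1+n⇒m<n∨m≡n t<1+K
  ... | q≡q′ , _   | inj₁ t<K  = trunc-injective K q≡q′ t t<K
  ... | _    , r≡r′ | inj₂ refl = toℕ-injective r≡r′

  trunc-+ : ∀ k e (x : ℕ → Fin b) → trunc b (k + e) x ≡ trunc b k x * b ^ e + trunc b e (shift x k)
  trunc-+ k zero x = begin
    trunc b (k + 0) x              ≡⟨ cong (λ K → trunc b K x) (+-identityʳ k) ⟩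
    trunc b k x                    ≡⟨ sym (*-identityʳ _) ⟩
    trunc b k x * 1                ≡⟨ sym (+-identityʳ _) ⟩
    trunc b k x * 1 + 0            ∎
    where open ≡-Reasoning
  trunc-+ k (suc e) x = begin
    trunc b (k + suc e) x
      ≡⟨ cong (λ K → trunc b K x) (+-suc k e) ⟩
    trunc b (k + e) x * b + toℕ (x (k + e))
      ≡⟨ cong (λ q → q * b + toℕ (x (k + e))) (trunc-+ k e x) ⟩
    (trunc b k x * b ^ e + trunc b e (shift x k)) * b + toℕ (x (k + e))
      ≡⟨ regroup (trunc b k x) (b ^ e) _ b _ ⟩
    trunc b k x * b ^ suc e + trunc b (suc e) (shift x k)
      ∎
    where
    open ≡-Reasoning
    regroup : ∀ t p r c d → (t * p + r) * c + d ≡ t * (c * p) + (r * c + d)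
    regroup = solve-∀

  trunc<b^K : ∀ K (x : ℕ → Fin b) → trunc b K x < b ^ K
  trunc<b^K zero    x = z<s
  trunc<b^K (suc K) x = begin-strict
    trunc b K x * b + toℕ (x K)  <⟨ q*n+r<[1+q]*n (trunc b K x) (toℕ<n (x K)) ⟩
    suc (trunc b K x) * b        ≤⟨ *-monoˡ-≤ b (trunc<b^K K x) ⟩
    b ^ K * b                    ≡⟨ *-comm (b ^ K) b ⟩
    b ^ suc K                    ∎
    where open ≤-Reasoning

  trunc-surjective : ∀ K U → U < b ^ K → ∃ λ (x : ℕ → Fin b) → trunc b K x ≡ U
  trunc-surjective zero    zero    _           = (λ _ → fromℕ< (>-nonZero⁻¹ b)) , refl
  trunc-surjective zero    (suc U) (s<s ())
  trunc-surjective (suc K) U U<b^1+K with quot-rem {b} U (b ^ K) {{m^n≢0 b K}} U<b^1+K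
  ... | q , r , q<b , r<b^K , refl with trunc-surjective K r r<b^K
  ...   | x , refl = (λ { zero → fromℕ< q<b ; (suc t) → x t }) ,
                     trans (trunc-+ 1 K _) (cong (λ q → q * b ^ K + trunc b K x) (toℕ-fromℕ< q<b))

  trunc-+-≥ : ∀ k e (x : ℕ → Fin b) → trunc b k x * b ^ e ≤ trunc b (k + e) x
  trunc-+-≥ k e x = ≤-trans (m≤m+n _ _) (≤-reflexive (sym (trunc-+ k e x)))

  trunc-+-< : ∀ k e (x : ℕ → Fin b) → trunc b (k + e) x < suc (trunc b k x) * b ^ e
  trunc-+-< k e x = begin-strict
    trunc b (k + e) x                            ≡⟨ trunc-+ k e x ⟩
    trunc b k x * b ^ e + trunc b e (shift x k)  <⟨ q*n+r<[1+q]*n (trunc b k x) (trunc<b^K e (shift x k)) ⟩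
    suc (trunc b k x) * b ^ e                    ∎
    where open ≤-Reasoning

  -- The cross-multiplied form of  trunc b K x / b ^ K ≤ (trunc b k x + 1) / b ^ k.
  trunc-scaled-≤ : ∀ k K (x : ℕ → Fin b) → b ^ k * trunc b K x ≤ suc (trunc b k x) * b ^ K
  trunc-scaled-≤ k K x with ≤-total k K
  ... | inj₁ k≤K with m≤n⇒∃[o]m+o≡n k≤K
  ...   | e , refl = begin
    b ^ k * trunc b (k + e) x            ≤⟨ *-monoʳ-≤ (b ^ k) (<⇒≤ (trunc-+-< k e x)) ⟩
    b ^ k * (suc (trunc b k x) * b ^ e)  ≡⟨ left-comm (b ^ k) (suc (trunc b k x)) (b ^ e) ⟩
    suc (trunc b k x) * (b ^ k * b ^ e)  ≡⟨ cong (suc (trunc b k x) *_) (sym (^-distribˡ-+-* b k e)) ⟩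
    suc (trunc b k x) * b ^ (k + e)      ∎
    where
    open ≤-Reasoning
    left-comm : ∀ p q r → p * (q * r) ≡ q * (p * r)
    left-comm = solve-∀
  trunc-scaled-≤ k K x | inj₂ K≤k with m≤n⇒∃[o]m+o≡n K≤k
  ...   | e , refl = begin
    b ^ (K + e) * trunc b K x        ≡⟨ cong (_* trunc b K x) (^-distribˡ-+-* b K e) ⟩
    b ^ K * b ^ e * trunc b K x      ≡⟨ rotate (b ^ K) (b ^ e) (trunc b K x) ⟩
    trunc b K x * b ^ e * b ^ K      ≤⟨ *-monoˡ-≤ (b ^ K) (trunc-+-≥ K e x) ⟩
    trunc b (K + e) x * b ^ K        ≤⟨ *-monoˡ-≤ (b ^ K) (n≤1+n (trunc b (K + e) x)) ⟩
    suc (trunc b (K + e) x) * b ^ K  ∎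
    where
    open ≤-Reasoning
    rotate : ∀ p q r → p * q * r ≡ r * q * p
    rotate = solve-∀

  1+trunc<b^K : ∀ e (x : ℕ → Fin b) → suc (toℕ (x e)) < b → suc (trunc b (suc e) x) < b ^ suc e
  1+trunc<b^K e x x[e]+1<b = begin-strict
    suc (trunc b e x * b + toℕ (x e))  ≡⟨ sym (+-suc _ _) ⟩
    trunc b e x * b + suc (toℕ (x e))  <⟨ q*n+r<[1+q]*n (trunc b e x) x[e]+1<b ⟩
    suc (trunc b e x) * b              ≤⟨ *-monoˡ-≤ b (trunc<b^K e x) ⟩
    b ^ e * b                          ≡⟨ *-comm (b ^ e) b ⟩
    b ^ suc e                          ∎
    where open ≤-Reasoning

  DigLt⇒trunc≤ : ∀ k {x c : ℕ → Fin b} → DigLt b x c → trunc b k x ≤ trunc b k c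
  DigLt⇒trunc≤ k {x} {c} (K , lt) with ≤-total k K
  ... | inj₁ k≤K with m≤n⇒∃[o]m+o≡n k≤K
  ...   | e , refl = s≤s⁻¹ (*-cancelʳ-< (b ^ e) (trunc b k x) (suc (trunc b k c)) (begin-strict
    trunc b k x * b ^ e        ≤⟨ trunc-+-≥ k e x ⟩
    trunc b (k + e) x          <⟨ <-trans (n<1+n _) lt ⟩
    trunc b (k + e) c          <⟨ trunc-+-< k e c ⟩
    suc (trunc b k c) * b ^ e  ∎))
    where open ≤-Reasoning
  DigLt⇒trunc≤ k {x} {c} (K , lt) | inj₂ K≤k with m≤n⇒∃[o]m+o≡n K≤k
  ...   | e , refl = <⇒≤ (begin-strict
    trunc b (K + e) x          <⟨ trunc-+-< K e x ⟩
    suc (trunc b K x) * b ^ e  ≤⟨ *-monoˡ-≤ (b ^ e) (<⇒≤ lt) ⟩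
    trunc b K c * b ^ e        ≤⟨ trunc-+-≥ K e c ⟩
    trunc b (K + e) c          ∎)
    where open ≤-Reasoning

  -- DigLt asks for a gap of two units at some precision; the second one comes from a
  -- non-maximal digit of x at a position p ≥ k, at precision p + 1.
  trunc<⇒DigLt : ∀ k {x c : ℕ → Fin b} → NotEventuallyMax b x → trunc b k x < trunc b k c → DigLt b x c
  trunc<⇒DigLt k {x} {c} nem lt with nem k
  ... | p , k≤p , x[p]+1≢b with m≤n⇒∃[o]m+o≡n k≤p
  ...   | e , refl = k + suc e , (begin-strict
    suc (trunc b (k + suc e) x)            ≡⟨ cong suc (trunc-+ k (suc e) x) ⟩
    suc (trunc b k x * b ^ suc e + R)      ≡⟨ sym (+-suc _ R) ⟩
    trunc b k x * b ^ suc e + suc R        <⟨ q*n+r<[1+q]*n (trunc b k x) (1+trunc<b^K e (shift x k) x[p]+1<b) ⟩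
    suc (trunc b k x) * b ^ suc e          ≤⟨ *-monoˡ-≤ (b ^ suc e) lt ⟩
    trunc b k c * b ^ suc e                ≤⟨ trunc-+-≥ k (suc e) c ⟩
    trunc b (k + suc e) c                  ∎)
    where
    open ≤-Reasoning
    R = trunc b (suc e) (shift x k)
    x[p]+1<b : suc (toℕ (x (k + e))) < b
    x[p]+1<b = ≤∧≢⇒< (toℕ<n (x (k + e))) x[p]+1≢b

  notEventuallyMax-shift : ∀ {x : ℕ → Fin b} n → NotEventuallyMax b x → NotEventuallyMax b (shift x n)
  notEventuallyMax-shift {x} n nem M with nem (M + n)
  ... | p , M+n≤p , x[p]+1≢b =
    p ∸ n , m+n≤o⇒m≤o∸n M M+n≤p ,
    subst (λ q → suc (toℕ (x q)) ≢ b) (sym (m+[n∸m]≡n (≤-trans (m≤n+m n M) M+n≤p))) x[p]+1≢b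

  occ-[] : ∀ L (w : ℕ → Fin b) → occ L w [] ≡ L
  occ-[] L w = trans (cong length (filter-all _ (universal (λ _ ()) (upTo L)))) (length-upTo L)

  nestedSemiPerfect⇒semiPerfect : ∀ k l (w : ℕ → Fin b) →
                                  NestedSemiPerfect b k l w → SemiPerfect b k l (l * b ^ k) w
  nestedSemiPerfect⇒semiPerfect zero    l w _      =
    refl , λ { [] → trans (occ-[] (l * 1) w) (*-identityʳ l) }
  nestedSemiPerfect⇒semiPerfect (suc k) l w nested =
    nested (suc k) (s≤s z≤n) ≤-refl 0 (m^n>0 b (suc k ∸ suc k))

  window≡⇔occursAt : ∀ {k} L (w x : ℕ → Fin b) i →
                     trunc b k (circWindow L w i) ≡ trunc b k x ⇔ OccursAt L w (tabulate {n = k} (x ∘ toℕ)) i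
  window≡⇔occursAt {k} L w x i = mk⇔
    (λ eq t → trans (trunc-injective k eq (toℕ t) (toℕ<n t)) (sym (lookup∘tabulate (x ∘ toℕ) t)))
    (λ occurs → trunc-cong k (λ t t<k →
      subst (λ s → w (circ L (i + s)) ≡ x s) (toℕ-fromℕ< t<k)
            (trans (occurs (fromℕ< t<k)) (lookup∘tabulate (x ∘ toℕ) (fromℕ< t<k)))))

  semiPerfect⇒#window≡ : ∀ {k l L} {w : ℕ → Fin b} → SemiPerfect b k l L w → ∀ U → U < b ^ k →
                         ∑[ i < L ] ind (does (trunc b k (circWindow L w i) ≟ U)) ≡ l
  semiPerfect⇒#window≡ {k} {l} {L} {w} (_ , perfect) U U<b^k with trunc-surjective k U U<b^k
  ... | x , refl = begin
    ∑[ i < L ] ind (does (trunc b k (circWindow L w i) ≟ trunc b k x))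
      ≡⟨ ∑-cong L (λ i _ → cong ind (does-⇔ (window≡⇔occursAt L w x i) (V i ≟ trunc b k x) (occursAt? i))) ⟩
    ∑[ i < L ] ind (does (occursAt? i))
      ≡⟨ sym (length-filter-applyUpTo occursAt? id L) ⟩
    occ L w u
      ≡⟨ perfect u ⟩
    l ∎
    where
    open ≡-Reasoning
    V = λ i → trunc b k (circWindow L w i)
    u = tabulate (x ∘ toℕ)
    occursAt? : ∀ i → Dec (OccursAt L w u i)
    occursAt? i = all? (λ t → w (circ L (i + toℕ t)) ≟ᶠ lookup u t)

  #below : ℕ → ℕ → (ℕ → ℕ → Fin b) → ℕ → ℕ
  #below k L y U = ∑[ i < L ] ind (does (trunc b k (y i) <? U))

  semiPerfect⇒#below-circWindow : ∀ {k l L} {w : ℕ → Fin b} → SemiPerfect b k l L w →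
                                  ∀ U → U ≤ b ^ k → #below k L (circWindow L w) U ≡ l * U
  semiPerfect⇒#below-circWindow {l = l} {L} _ zero _ = trans (∑-zero L) (sym (*-zeroʳ l))
  semiPerfect⇒#below-circWindow {k} {l} {L} {w} semiPerfect (suc U) U<b^k = begin
    #below k L (circWindow L w) (suc U)                              ≡⟨ ∑-cong L (λ i _ → ind-<-suc (V i) U) ⟩
    ∑[ i < L ] (ind (does (V i <? U)) + ind (does (V i ≟ U)))        ≡⟨ ∑-distrib-+ L _ _ ⟩
    #below k L (circWindow L w) U + ∑[ i < L ] ind (does (V i ≟ U))  ≡⟨ cong₂ _+_ below-U exactly-l ⟩
    l * U + l                                                        ≡⟨ +-comm (l * U) l ⟩
    l + l * U                                                        ≡⟨ sym (*-suc l U) ⟩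
    l * suc U                                                        ∎
    where
    open ≡-Reasoning
    V = λ i → trunc b k (circWindow L w i)
    below-U = semiPerfect⇒#below-circWindow {w = w} semiPerfect U (<⇒≤ U<b^k)
    exactly-l = semiPerfect⇒#window≡ {w = w} semiPerfect U U<b^k

  #below-≤-+ : ∀ k L {y y′ : ℕ → ℕ → Fin b} U →
               (∀ i → i + k ≤ L → trunc b k (y i) ≡ trunc b k (y′ i)) →
               #below k L y U ≤ #below k L y′ U + k
  #below-≤-+ k L U agree =
    ∑-≤-∑-+-tail L k _ _ (λ _ → ind≤1 _) (λ i i+k≤L → cong (λ v → ind (does (v <? U))) (agree i i+k≤L))

  trunc-shift≡window : ∀ k L s0 (a : ℕ → Fin b) i → i + k ≤ L →
                       trunc b k (shift a (s0 + i)) ≡ trunc b k (circWindow L (shift a s0) i)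
  trunc-shift≡window k L s0 a i i+k≤L = trunc-cong k (λ t t<k →
    cong a (trans (+-assoc s0 i t) (cong (s0 +_) (sym (circ-< (<-≤-trans (+-monoʳ-< i t<k) i+k≤L))))))

  semiPerfect⇒#below≈ : ∀ {k l L s0} {a : ℕ → Fin b} → SemiPerfect b k l L (shift a s0) →
                        ∀ U → U ≤ b ^ k → let P = #below k L (shift a ∘ (s0 +_)) U in
                        P ≤ l * U + k × l * U ≤ P + k
  semiPerfect⇒#below≈ {k} {l} {L} {s0} {a} semiPerfect U U≤b^k =
    subst (λ n → #below k L (shift a ∘ (s0 +_)) U ≤ n + k) circular
          (#below-≤-+ k L U (trunc-shift≡window k L s0 a)) ,
    subst (λ n → n ≤ #below k L (shift a ∘ (s0 +_)) U + k) circular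
          (#below-≤-+ k L U (λ i i+k≤L → sym (trunc-shift≡window k L s0 a i i+k≤L)))
    where
    circular = semiPerfect⇒#below-circWindow {w = shift a s0} semiPerfect U U≤b^k

  -- NearCount without truncated subtraction, which makes it additive over blocks.
  record CountBound (c : ℕ → Fin b) (N A S : ℕ) : Set where
    constructor countBound
    field
      upper : ∀ K → N * trunc b K c ≤ (A + S) * b ^ K
      lower : ∀ K → A * b ^ K ≤ N * suc (trunc b K c) + S * b ^ K

  countBound-+ : ∀ {c N N′ A A′ S S′} → CountBound c N A S → CountBound c N′ A′ S′ →
                 CountBound c (N + N′) (A + A′) (S + S′)
  countBound-+ {c} {N} {N′} {A} {A′} {S} {S′} (countBound upper lower) (countBound upper′ lower′) =
    countBound upper″ lower″
    where
    open ≤-Reasoning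
    upper″ : ∀ K → (N + N′) * trunc b K c ≤ (A + A′ + (S + S′)) * b ^ K
    upper″ K = begin
      (N + N′) * t                  ≡⟨ *-distribʳ-+ t N N′ ⟩
      N * t + N′ * t                ≤⟨ +-mono-≤ (upper K) (upper′ K) ⟩
      (A + S) * B + (A′ + S′) * B   ≡⟨ sym (*-distribʳ-+ B (A + S) (A′ + S′)) ⟩
      (A + S + (A′ + S′)) * B       ≡⟨ cong (_* B) (interchange A S A′ S′) ⟩
      (A + A′ + (S + S′)) * B       ∎
      where t = trunc b K c ; B = b ^ K
    lower″ : ∀ K → (A + A′) * b ^ K ≤ (N + N′) * suc (trunc b K c) + (S + S′) * b ^ K
    lower″ K = begin
      (A + A′) * B                                 ≡⟨ *-distribʳ-+ B A A′ ⟩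
      A * B + A′ * B                               ≤⟨ +-mono-≤ (lower K) (lower′ K) ⟩
      (N * suc t + S * B) + (N′ * suc t + S′ * B)  ≡⟨ regroup N N′ (suc t) S S′ B ⟩
      (N + N′) * suc t + (S + S′) * B              ∎
      where
      t = trunc b K c
      B = b ^ K
      regroup : ∀ n n′ u s s′ v → (n * u + s * v) + (n′ * u + s′ * v) ≡ (n + n′) * u + (s + s′) * v
      regroup = solve-∀

  countBound⇒nearCount : ∀ {c N A S} → CountBound c N A S → NearCount b N A S c
  countBound⇒nearCount {c} {N} {A} {S} (countBound upper lower) = upper , λ K → begin
    (A ∸ S) * b ^ K                          ≡⟨ *-distribʳ-∸ (b ^ K) A S ⟩
    A * b ^ K ∸ S * b ^ K                    ≤⟨ ∸-monoˡ-≤ (S * b ^ K) (lower K) ⟩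
    N * suc (trunc b K c) + S * b ^ K ∸ S * b ^ K ≡⟨ m+n∸n≡m (N * suc (trunc b K c)) (S * b ^ K) ⟩
    N * suc (trunc b K c)                    ≡⟨ cong (N *_) (+-comm 1 (trunc b K c)) ⟩
    N * (trunc b K c + 1)                    ∎
    where open ≤-Reasoning

  -- T / b^k approximates c to within b^-k, so a count within k of l T is within k + l of l b^k c.
  countBound-block : ∀ {k l A} c → l * trunc b k c ≤ A + k → A ≤ l * suc (trunc b k c) + k →
                     CountBound c (l * b ^ k) A (k + l)
  countBound-block {k} {l} {A} c lT≤A+k A≤l[T+1]+k = countBound upper lower
    where
    open ≤-Reasoning
    T = trunc b k c
    upper : ∀ K → l * b ^ k * trunc b K c ≤ (A + (k + l)) * b ^ K
    upper K = begin
      l * b ^ k * t        ≡⟨ *-assoc l (b ^ k) t ⟩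
      l * (b ^ k * t)      ≤⟨ *-monoʳ-≤ l (trunc-scaled-≤ k K c) ⟩
      l * (suc T * b ^ K)  ≡⟨ sym (*-assoc l (suc T) (b ^ K)) ⟩
      l * suc T * b ^ K    ≤⟨ *-monoˡ-≤ (b ^ K) (begin
        l * suc T            ≡⟨ *-suc l T ⟩
        l + l * T            ≤⟨ +-monoʳ-≤ l lT≤A+k ⟩
        l + (A + k)          ≡⟨ rotate l A k ⟩
        A + (k + l)          ∎) ⟩
      (A + (k + l)) * b ^ K  ∎
      where
      t = trunc b K c
      rotate : ∀ l A k → l + (A + k) ≡ A + (k + l)
      rotate = solve-∀
    lower : ∀ K → A * b ^ K ≤ l * b ^ k * suc (trunc b K c) + (k + l) * b ^ K
    lower K = begin
      A * b ^ K                          ≤⟨ *-monoˡ-≤ (b ^ K) (≤-trans A≤l[T+1]+k (≤-reflexive (rotate l T k))) ⟩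
      (l * T + (k + l)) * b ^ K          ≡⟨ *-distribʳ-+ (b ^ K) (l * T) (k + l) ⟩
      l * T * b ^ K + (k + l) * b ^ K    ≤⟨ +-monoˡ-≤ ((k + l) * b ^ K) (begin
        l * T * b ^ K        ≡⟨ swap l T (b ^ K) ⟩
        l * (b ^ K * T)      ≤⟨ *-monoʳ-≤ l (trunc-scaled-≤ K k c) ⟩
        l * (suc t * b ^ k)  ≡⟨ sym (swap l (b ^ k) (suc t)) ⟩
        l * b ^ k * suc t    ∎) ⟩
      l * b ^ k * suc t + (k + l) * b ^ K  ∎
      where
      t = trunc b K c
      rotate : ∀ l T k → l * suc T + k ≡ l * T + (k + l)
      rotate = solve-∀
      swap : ∀ l p q → l * p * q ≡ l * (q * p)
      swap = solve-∀

  countBound-semiPerfectBlock : ∀ {k l L s0} {a c : ℕ → Fin b} (χ : ℕ → Bool) →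
    NotEventuallyMax b a → SemiPerfect b k l L (shift a s0) →
    (∀ i → i < L → χ (s0 + i) ≡ true ⇔ DigLt b (shift a (s0 + i)) c) →
    CountBound c L (∑[ i < L ] ind (χ (s0 + i))) (k + l)
  countBound-semiPerfectBlock {k} {l} {L} {s0} {a} {c} χ nem semiPerfect@(refl , _) χ⇔ =
    countBound-block c (≤-trans (proj₂ (#below≈ T (<⇒≤ T<b^k))) (+-monoˡ-≤ k #below[T]≤A))
                       (≤-trans A≤#below[1+T] (proj₁ (#below≈ (suc T) T<b^k)))
    where
    T = trunc b k c
    T<b^k = trunc<b^K k c
    y = shift a ∘ (s0 +_)
    A = ∑[ i < L ] ind (χ (s0 + i))
    #below≈ = semiPerfect⇒#below≈ {s0 = s0} {a} semiPerfect
    #below[T]≤A : #below k L y T ≤ A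
    #below[T]≤A = ∑-mono-≤ L (λ i i<L → ind-does-≤ (trunc b k (y i) <? T) (λ lt →
      Equivalence.from (χ⇔ i i<L) (trunc<⇒DigLt k (notEventuallyMax-shift (s0 + i) nem) lt)))
    A≤#below[1+T] : A ≤ #below k L y (suc T)
    A≤#below[1+T] = ∑-mono-≤ L (λ i i<L → ind-≤-does (trunc b k (y i) <? suc T) (λ χ≡true →
      s≤s (DigLt⇒trunc≤ k (Equivalence.to (χ⇔ i i<L) χ≡true))))

  blocksLength : (f g : ℕ → ℕ) → ℕ → ℕ
  blocksLength f g = sum1 (λ t → g t * b ^ f t)

  countBound-nestedBlocks : ∀ (f g : ℕ → ℕ) {a c : ℕ → Fin b} {N} (χ : ℕ → Bool) → NotEventuallyMax b a →
    ((j : ℕ) → 1 ≤ j → NestedSemiPerfect b (f j) (g j) (shift a (blocksLength f g (j ∸ 1)))) →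
    (∀ n → n < N → χ n ≡ true ⇔ DigLt b (shift a n) c) →
    ∀ M → blocksLength f g M ≤ N →
    CountBound c (blocksLength f g M) (∑[ n < blocksLength f g M ] ind (χ n)) (sum1 f M + sum1 g M)
  countBound-nestedBlocks f g χ nem nested χ⇔ zero    _   = countBound (λ _ → z≤n) (λ _ → z≤n)
  countBound-nestedBlocks f g {a} {c} χ nem nested χ⇔ (suc M) s0+L≤N =
    subst₂ (CountBound c (s0 + L)) (sym (∑-split s0 L (ind ∘ χ))) (interchange (sum1 f M) (sum1 g M) k l)
      (countBound-+ (countBound-nestedBlocks f g χ nem nested χ⇔ M (≤-trans (m≤m+n s0 L) s0+L≤N))
                    (countBound-semiPerfectBlock {s0 = s0} χ nem
                      (nestedSemiPerfect⇒semiPerfect k l (shift a s0) (nested (suc M) (s≤s z≤n)))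
                      (λ i i<L → χ⇔ (s0 + i) (<-≤-trans (+-monoʳ-< s0 i<L) s0+L≤N))))
    where
    k = f (suc M)
    l = g (suc M)
    L = l * b ^ k
    s0 = blocksLength f g M

corollary1 : (b : ℕ) → 2 ≤ b → (f g : ℕ → ℕ) → (a : ℕ → Fin b) →
    NotEventuallyMax b a →
    ((j : ℕ) → 1 ≤ j →
      NestedSemiPerfect b (f j) (g j) (λ i → a (sum1 (λ t → g t * b ^ f t) (j ∸ 1) + i))) →
    (m : ℕ) → 2 ≤ m →
    StarDiscBound b a (sum1 (λ t → g t * b ^ f t) (m ∸ 1)) (sum1 f (m ∸ 1) + sum1 g (m ∸ 1))
corollary1 b 2≤b f g a nem nested m _ c _ s ∈⇔DigLt =
  countBound⇒nearCount b (subst (λ A → CountBound b c N A S) (sym (∣∣≡∑χ s))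
    (countBound-nestedBlocks b f g (χ s) nem nested (χ⇔ s ∈⇔DigLt) (m ∸ 1) ≤-refl))
  where
  instance
    b≢0 : NonZero b
    b≢0 = >-nonZero (<-≤-trans z<s 2≤b)
  N = blocksLength b f g (m ∸ 1)
  S = sum1 f (m ∸ 1) + sum1 g (m ∸ 1)
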